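{- For every connected graph $G$ with at least three vertices and minimum degree one, $\mathrm{evc}(G)\ne\mathrm{mvc}(G)$.
   Context: All graphs are finite and simple. $\mathrm{mvc}(G)$ denotes the minimum cardinality of a vertex cover of $G$. Eternal vertex cover game: guards are placed on vertices of $G$, at most one guard per vertex; the set of occupied vertices is a configuration. In each round an attacker chooses an edge $uv$; the defender responds by moving guards simultaneously, each guard either staying put or moving to an adjacent vertex, such that at least one guard moves across the attacked edge, and after the move at most one guard is on each vertex; the number of guards never changes. An eternal vertex cover class of $G$ is a family $\mathcal{C}$ of vertex covers of $G$, all of the same cardinality, such that for every configuration $S\in\mathcal{C}$ and every attacked edge, the attack can be defended by a legal move leading to a configuration in $\mathcal{C}$. The eternal vertex cover number $\mathrm{evc}(G)$ is the minimum cardinality of a configuration of an eternal vertex cover class of $G$. -}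

module Defs where

open import Data.Nat using (ℕ; _≤_; _+_)
open import Data.Bool using (Bool; true; false; if_then_else_)
open import Data.Fin using (Fin)
open import Data.Fin.Subset using (Subset; _∈_; ∣_∣)
open import Data.List using (List; map; allFin)
open import Data.Nat.ListAction using (sum)
open import Data.Product using (Σ; ∃; _×_)
open import Data.Sum using (_⊎_)
open import Relation.Binary.PropositionalEquality using (_≡_)
open import Relation.Nullary using (¬_)
open import Level using () renaming (suc to lsuc; zero to lzero)

record Graph (n : ℕ) : Set where
  field
    adj    : Fin n → Fin n → Bool
    sym    : ∀ u v → adj u v ≡ adj v u
    irrefl : ∀ v → adj v v ≡ false
open Graph public

Adj : ∀ {n} → Graph n → Fin n → Fin n → Set
Adj G u v = adj G u v ≡ true

deg : ∀ {n} → Graph n → Fin n → ℕ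
deg {n} G v = sum (map (λ u → if adj G v u then 1 else 0) (allFin n))

MinDegreeOne : ∀ {n} → Graph n → Set
MinDegreeOne G = (∀ v → 1 ≤ deg G v) × ∃ (λ v → deg G v ≡ 1)

data Walk {n} (G : Graph n) : Fin n → Fin n → Set where
  here : ∀ {u} → Walk G u u
  step : ∀ {u v w} → Adj G u v → Walk G v w → Walk G u w

Connected : ∀ {n} → Graph n → Set
Connected G = ∀ u v → Walk G u v

IsVertexCover : ∀ {n} → Graph n → Subset n → Set
IsVertexCover G S = ∀ u v → Adj G u v → (u ∈ S) ⊎ (v ∈ S)

IsMVC : ∀ {n} → Graph n → ℕ → Set
IsMVC G k = (Σ _ λ S → IsVertexCover G S × ∣ S ∣ ≡ k)
          × (∀ S → IsVertexCover G S → k ≤ ∣ S ∣)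

-- A legal move from configuration S to configuration S' defending the
-- attacked edge uv: each guard at x ∈ S moves to m x, which is x or a
-- neighbour of x; no two guards end on the same vertex; the set of
-- final positions is S'; some guard crosses the edge uv.
LegalDefence : ∀ {n} → Graph n → Subset n → Subset n → Fin n → Fin n → Set
LegalDefence {n} G S S' u v =
  Σ (Fin n → Fin n) λ m →
      (∀ x → x ∈ S → (m x ≡ x) ⊎ Adj G x (m x))
    × (∀ x y → x ∈ S → y ∈ S → m x ≡ m y → x ≡ y)
    × (∀ y → y ∈ S' → Σ _ λ x → x ∈ S × m x ≡ y)
    × (∀ x → x ∈ S → m x ∈ S')
    × ((u ∈ S × m u ≡ v) ⊎ (v ∈ S × m v ≡ u))

IsEVCClass : ∀ {n} → Graph n → ℕ → (Subset n → Set) → Set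
IsEVCClass G k 𝒞 =
    (∀ S → 𝒞 S → IsVertexCover G S × ∣ S ∣ ≡ k)
  × (∀ S → 𝒞 S → ∀ u v → Adj G u v →
       Σ _ λ S' → 𝒞 S' × LegalDefence G S S' u v)

IsEVC : ∀ {n} → Graph n → ℕ → Set₁
IsEVC {n} G k =
    (Σ (Subset n → Set) λ 𝒞 → IsEVCClass G k 𝒞 × (Σ _ λ S → 𝒞 S))
  × (∀ k' (𝒞 : Subset n → Set) → IsEVCClass G k' 𝒞 → (Σ _ λ S → 𝒞 S) → k ≤ k')

-- Let v be a pendant vertex with neighbour w; since G is connected with at
-- least three vertices, w has a neighbour x ≠ v. Suppose a class 𝒞 of
-- mvc(G)-sized configurations defends eternally. No minimum vertex cover
-- contains both v and w, since dropping v leaves a cover. So a configuration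
-- containing v misses w; defending the attack on wx then moves the guard on x
-- onto w while the guard on v cannot move, giving a configuration containing
-- both v and w. A configuration missing v contains w, and defending
-- the attack on vw puts a guard on v. Hence 𝒞 is empty.
module Submission where

open import Defs
open import Data.Nat using (ℕ; _≤_; suc; s≤s; pred)
open import Data.Nat.Properties using (<⇒≱)
open import Data.Bool using (Bool; true; false; if_then_else_)
open import Data.Fin using (Fin; _≟_) renaming (zero to fzero; suc to fsuc)
open import Data.Fin.Subset using (Subset; _∈_; _∉_; ∣_∣; _-_)
open import Data.Fin.Subset.Properties using (_∈?_; x∈p∧x≢y⇒x∈p-y; x∈p⇒∣p-x∣<∣p∣)
open import Data.List using (tabulate)
open import Data.List.Properties using (map-tabulate)
open import Data.Nat.ListAction using (sum)
open import Data.Product using (Σ; _×_; _,_; proj₁; proj₂)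
open import Data.Sum using (inj₁; inj₂)
open import Data.Empty using (⊥; ⊥-elim)
open import Relation.Nullary using (yes; no)
open import Relation.Binary.PropositionalEquality
  using (_≡_; _≢_; refl; trans; cong; subst) renaming (sym to ≡-sym)
open import Function using (_∘_)

count : ∀ {n} → (Fin n → Bool) → ℕ
count g = sum (tabulate (λ u → if g u then 1 else 0))

count≡0⇒false : ∀ {n} (g : Fin n → Bool) → count g ≡ 0 → ∀ y → g y ≡ false
count≡0⇒false {suc n} g c≡0 y with g fzero in g0
count≡0⇒false g c≡0 fzero    | false = g0
count≡0⇒false g c≡0 (fsuc y) | false = count≡0⇒false (g ∘ fsuc) c≡0 y

count≡1⇒unique-true : ∀ {n} (g : Fin n → Bool) → count g ≡ 1 →
  Σ (Fin n) λ w → g w ≡ true × (∀ y → g y ≡ true → y ≡ w)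
count≡1⇒unique-true {suc n} g c≡1 with g fzero in g0
... | true = fzero , g0 , only-zero
  where
  only-zero : ∀ y → g y ≡ true → y ≡ fzero
  only-zero fzero    _  = refl
  only-zero (fsuc y) gy with () ← trans (≡-sym (count≡0⇒false (g ∘ fsuc) (cong pred c≡1) y)) gy
... | false with count≡1⇒unique-true (g ∘ fsuc) c≡1
...   | w , gw , unique = fsuc w , gw , only-w
  where
  only-w : ∀ y → g y ≡ true → y ≡ fsuc w
  only-w fzero    gy with () ← trans (≡-sym g0) gy
  only-w (fsuc y) gy = cong fsuc (unique y gy)

∃-distinct-from-two : ∀ {n} → 3 ≤ n → (v w : Fin n) → Σ (Fin n) λ z → z ≢ v × z ≢ w
∃-distinct-from-two (s≤s (s≤s (s≤s _))) v w with fzero ≟ v | fzero ≟ w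
... | no 0≢v   | no 0≢w   = fzero , 0≢v , 0≢w
... | yes refl | yes refl = fsuc fzero , (λ ()) , (λ ())
... | yes refl | no _ with fsuc fzero ≟ w
...   | no 1≢w   = fsuc fzero , (λ ()) , 1≢w
...   | yes refl = fsuc (fsuc fzero) , (λ ()) , (λ ())
∃-distinct-from-two (s≤s (s≤s (s≤s _))) v w | no _ | yes refl with fsuc fzero ≟ v
...   | no 1≢v   = fsuc fzero , 1≢v , (λ ())
...   | yes refl = fsuc (fsuc fzero) , (λ ()) , (λ ())

module _ {n : ℕ} (G : Graph n) where

  Adj-sym : ∀ {u v} → Adj G u v → Adj G v u
  Adj-sym {u} {v} uv = trans (Graph.sym G v u) uv

  Adj⇒≢ : ∀ {u v} → Adj G u v → u ≢ v
  Adj⇒≢ {u} uv refl with () ← trans (≡-sym (Graph.irrefl G u)) uv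

  deg≡1⇒unique-neighbour : ∀ v → deg G v ≡ 1 →
    Σ (Fin n) λ w → Adj G v w × (∀ y → Adj G v y → y ≡ w)
  deg≡1⇒unique-neighbour v d≡1 = count≡1⇒unique-true (adj G v)
    (trans (≡-sym (cong sum (map-tabulate (λ u → u) (λ u → if adj G v u then 1 else 0)))) d≡1)

  module Pendant (v w : Fin n) (only-w : ∀ y → Adj G v y → y ≡ w) where

    other-neighbour : ∀ {p} → Walk G p w → p ≢ w → p ≢ v →
      Σ (Fin n) λ x → Adj G w x × x ≢ v
    other-neighbour here p≢w _ = ⊥-elim (p≢w refl)
    other-neighbour {p} (step {v = a} pa rest) p≢w p≢v with a ≟ w | a ≟ v
    ... | yes refl | _        = p , Adj-sym pa , p≢v
    ... | no _     | yes refl = ⊥-elim (p≢w (only-w p (Adj-sym pa)))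
    ... | no a≢w   | no a≢v   = other-neighbour rest a≢w a≢v

    cover-minus-pendant : ∀ {S} → IsVertexCover G S → w ∈ S → w ≢ v →
      IsVertexCover G (S - v)
    cover-minus-pendant {S} cover wS w≢v a b ab with cover a b ab | a ≟ v | b ≟ v
    ... | inj₁ aS | no a≢v   | _        = inj₁ (x∈p∧x≢y⇒x∈p-y aS a≢v)
    ... | inj₂ bS | _        | no b≢v   = inj₂ (x∈p∧x≢y⇒x∈p-y bS b≢v)
    ... | _       | yes refl | _        =
      inj₂ (subst (_∈ S - v) (≡-sym (only-w b ab)) (x∈p∧x≢y⇒x∈p-y wS w≢v))
    ... | _       | _        | yes refl =
      inj₁ (subst (_∈ S - v) (≡-sym (only-w a (Adj-sym ab))) (x∈p∧x≢y⇒x∈p-y wS w≢v))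

    min-cover-excludes-both : ∀ {k S} → (∀ T → IsVertexCover G T → k ≤ ∣ T ∣) →
      IsVertexCover G S → ∣ S ∣ ≡ k → v ∈ S → w ∈ S → w ≢ v → ⊥
    min-cover-excludes-both {S = S} minimal cover ∣S∣≡k vS wS w≢v =
      <⇒≱ (x∈p⇒∣p-x∣<∣p∣ vS)
        (subst (_≤ ∣ S - v ∣) (≡-sym ∣S∣≡k) (minimal (S - v) (cover-minus-pendant cover wS w≢v)))

    pendant-guard-stays : ∀ {S S' a b x} → (d : LegalDefence G S S' a b) →
      v ∈ S → x ∈ S → x ≢ v → proj₁ d x ≡ w → v ∈ S'
    pendant-guard-stays (m , moves , injective , _ , lands , _) vS xS x≢v mx≡w
      with moves v vS
    ... | inj₁ mv≡v = subst (_∈ _) mv≡v (lands v vS)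
    ... | inj₂ v~mv = ⊥-elim (x≢v (≡-sym (injective v _ vS xS (trans (only-w _ v~mv) (≡-sym mx≡w)))))

  defence-fills-empty-end : ∀ {S S' a b} → (d : LegalDefence G S S' a b) → a ∉ S →
    b ∈ S × proj₁ d b ≡ a
  defence-fills-empty-end (_ , _ , _ , _ , _ , inj₁ (aS , _)) a∉S = ⊥-elim (a∉S aS)
  defence-fills-empty-end (_ , _ , _ , _ , _ , inj₂ crossing)  _   = crossing

  defence-lands-in : ∀ {S S' a b x} → (d : LegalDefence G S S' a b) → x ∈ S →
    proj₁ d x ∈ S'
  defence-lands-in (_ , _ , _ , _ , lands , _) = lands _

  module MinimumClass (v w x : Fin n) (only-w : ∀ y → Adj G v y → y ≡ w)
    (vw : Adj G v w) (wx : Adj G w x) (x≢v : x ≢ v)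
    {k : ℕ} (minimal : ∀ T → IsVertexCover G T → k ≤ ∣ T ∣)
    {𝒞 : Subset n → Set} (class : IsEVCClass G k 𝒞) where
    open Pendant v w only-w
    open Σ class renaming (proj₁ to valid; proj₂ to defend)

    w≢v : w ≢ v
    w≢v = Adj⇒≢ (Adj-sym vw)

    excludes-both : ∀ {S} → 𝒞 S → v ∈ S → w ∈ S → ⊥
    excludes-both cS vS wS =
      min-cover-excludes-both minimal (proj₁ (valid _ cS)) (proj₂ (valid _ cS)) vS wS w≢v

    excludes-pendant : ∀ {S} → 𝒞 S → v ∈ S → ⊥
    excludes-pendant {S} cS vS with w ∈? S
    ... | yes wS = excludes-both cS vS wS
    ... | no w∉S with defend S cS w x wx
    ...   | S' , cS' , d with defence-fills-empty-end d w∉S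
    ...     | xS , mx≡w = excludes-both cS' (pendant-guard-stays d vS xS x≢v mx≡w)
                            (subst (_∈ S') mx≡w (defence-lands-in d xS))

    empty : ∀ {S} → 𝒞 S → ⊥
    empty {S} cS with v ∈? S
    ... | yes vS = excludes-pendant cS vS
    ... | no v∉S with defend S cS v w vw
    ...   | S' , cS' , d with defence-fills-empty-end d v∉S
    ...     | wS , mw≡v = excludes-pendant cS' (subst (_∈ S') mw≡v (defence-lands-in d wS))

corollary1 : (n : ℕ) → 3 ≤ n → (G : Graph n) → Connected G → MinDegreeOne G →
    (k l : ℕ) → IsMVC G k → IsEVC G l → l ≢ k
corollary1 n n≥3 G connected (_ , v , deg-v≡1) k l (_ , minimal) ((𝒞 , class , S , cS) , _) refl
  with deg≡1⇒unique-neighbour G v deg-v≡1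
... | w , vw , only-w with ∃-distinct-from-two n≥3 v w
... | z , z≢v , z≢w with Pendant.other-neighbour G v w only-w (connected z w) z≢w z≢v
... | x , wx , x≢v = MinimumClass.empty G v w x only-w vw wx x≢v minimal class cS
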